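{- Let $\tau,\sigma$ be increasing words of positive integers such that the concatenation $\tau\sigma$ is a reduced word. Then the word $\mathrm{drop}(\tau\sigma)$ is Coxeter–Knuth equivalent to $\tau\sigma$.
   Context: Reduced words: a word $(\rho_\ell,\ldots,\rho_1)$ of positive integers ($\rho_\ell$ leftmost) is reduced if $w=s_{\rho_\ell}\cdots s_{\rho_1}$ for a permutation $w$ with exactly $\ell$ inversions, $s_i$ the simple transposition $(i\ i{+}1)$. Coxeter–Knuth equivalence. For $\rho=(\rho_m,\ldots,\rho_1)$: $\mathfrak c_j$ ($1\le j<m$) swaps $\rho_j,\rho_{j+1}$ if $|\rho_j-\rho_{j+1}|>1$, else identity; $\mathfrak b_j$ ($1<j<m$) replaces $\rho_{j+1}\rho_j\rho_{j-1}$ by $\rho_j\rho_{j+1}\rho_j$ if $\rho_{j+1}=\rho_{j-1}$, else identity. $\mathfrak d_i(\rho)$ ($1<i<m$) equals $\mathfrak b_i(\rho)$ if $\rho_{i+1}=\rho_{i-1}=\rho_i\pm1$; $\mathfrak c_{i-1}(\rho)$ if $\rho_{i-1}>\rho_{i+1}>\rho_i$ or $\rho_{i-1}<\rho_{i+1}<\rho_i$; $\mathfrak c_i(\rho)$ if $\rho_{i+1}>\rho_{i-1}>\rho_i$ or $\rho_{i+1}<\rho_{i-1}<\rho_i$; $\rho$ otherwise. Coxeter–Knuth equivalence is the equivalence relation generated by the $\mathfrak d_i$. Drop. Here increasing words are written left to right, $\tau=\tau_1\cdots\tau_t$ with $\tau_1<\cdots<\tau_t$ and $\sigma=\sigma_1\cdots\sigma_s$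 with $\sigma_1<\cdots<\sigma_s$. The drop alignment of $\sigma$ below $\tau$ places the letters of $\sigma$, in order, into columns below a row containing $\tau$ in columns $1,\dots,t$: if $\tau_j>\sigma_j$ for all $j\le\min(s,t)$, $\sigma_j$ is placed in column $j$ for every $j$; otherwise, with $j_1$ the least index with $\tau_{j_1}\le\sigma_{j_1}$, $\sigma_1,\dots,\sigma_{j_1-1}$ go to columns $1,\dots,j_1-1$, column $j_1$ receives no letter of $\sigma$, and $\sigma_{j_1}\cdots\sigma_s$ is placed by applying the procedure recursively below $\tau_{j_1+1}\cdots\tau_t$ (columns $j_1+1,\dots$). Let $x_1,\dots,x_k$ be, from left to right, the letters of $\tau$ with no letter of $\sigma$ below them. This yields factorizations into consecutive (possibly empty) segments $\tau=\tau^{(0)}x_1\tau^{(1)}\cdots x_k\tau^{(k)}$ and $\sigma=\sigma^{(0)}\sigma^{(1)}\cdots\sigma^{(k)}\sigma^{(k+1)}$, where $\sigma^{(j)}$ ($0\le j\le k$) lies directly below $\tau^{(j)}$ and $\sigma^{(k+1)}$ consists of the letters placed right of column $t$. Then $\mathrm{drop}(\tau\sigma)$ is the word $\tau^{(0)}\tau^{(1)}\cdots\tau^{(k)}\,\sigma^{(0)}x_1\hat\sigma^{(1)}x_2\hat\sigma^{(2)}\cdots x_k\hat\sigma^{(k)}\sigma^{(k+1)}$, where for $1\le j\le k$: $\hat\sigma^{(j)}_i=\sigma^{(j)}_i+1$ for $1\le i\le b_j$ and $\hat\sigma^{(j)}_i=\sigma^{(j)}_i$ for $i>b_j$, with $b_j=\max\{b\ge0:\tau^{(j)}_i=\sigma^{(j)}_1+i\text{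 for all }1\le i\le b\}$ if $x_j=\tau^{(j)}_1-1$, and $b_j=0$ otherwise. -}

module Defs where

open import Data.Nat using (ℕ; zero; suc; _+_; _∸_; _<_; _≤_; _⊔_; _≡ᵇ_; _<ᵇ_)
open import Data.Bool using (Bool; true; false; if_then_else_; _∧_; _∨_)
open import Data.List using (List; []; _∷_; _++_; length; map; concat; concatMap; foldr; filter; applyUpTo; cartesianProduct)
open import Data.Maybe using (Maybe; just; nothing)
open import Data.Product using (_×_; _,_; proj₁; proj₂; Σ; ∃)
open import Relation.Nullary.Decidable using (does)
open import Relation.Binary.PropositionalEquality using (_≡_)
open import Relation.Binary.Construct.Closure.Equivalence using (EqClosure)
open import Data.List.Relation.Unary.Linked using (Linked)
open import Data.List.Relation.Unary.All using (All)

-- Words are lists written LEFT TO RIGHT.  For a word ρ = (ρ_m,…,ρ_1)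
-- (ρ_m leftmost) the list is  ρ_m ∷ … ∷ ρ_1 ∷ [].

Word : Set
Word = List ℕ

sTr : ℕ → ℕ → ℕ
sTr i j = if j ≡ᵇ i then suc i else (if j ≡ᵇ suc i then i else j)

-- w = s_{ρ_ℓ} ⋯ s_{ρ_1} as a function: w(j) = s_{ρ_ℓ}(⋯ s_{ρ_1}(j))
perm : Word → ℕ → ℕ
perm ρ j = foldr sTr j ρ

maxLetter : Word → ℕ
maxLetter = foldr _⊔_ 0

-- number of inversions of w = perm ρ : pairs 1 ≤ i < j ≤ N with w(i) > w(j),
-- where N = max letter + 1 (w fixes every point beyond N).
countTrue : {A : Set} → (A → Bool) → List A → ℕ
countTrue f [] = 0
countTrue f (x ∷ xs) = if f x then suc (countTrue f xs) else countTrue f xs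

inversions : Word → ℕ
inversions ρ =
  countTrue (λ p → (proj₁ p <ᵇ proj₂ p) ∧ (perm ρ (proj₂ p) <ᵇ perm ρ (proj₁ p)))
            (cartesianProduct rng rng)
  where
  rng : List ℕ
  rng = applyUpTo suc (suc (maxLetter ρ))

Reduced : Word → Set
Reduced ρ = inversions ρ ≡ length ρ

-- Coxeter–Knuth moves.  Letter ρ_j (j counted from the right, 1-based)
-- sits at 0-based left position m − j, m = length ρ.

nthL : Word → ℕ → ℕ
nthL [] _ = 0
nthL (x ∷ xs) zero = x
nthL (x ∷ xs) (suc n) = nthL xs n

letter : Word → ℕ → ℕ
letter ρ j = nthL ρ (length ρ ∸ j)

farApart : ℕ → ℕ → Bool
farApart a b = (suc a <ᵇ b) ∨ (suc b <ᵇ a)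

swapAt : ℕ → Word → Word
swapAt zero (a ∷ b ∷ r) = if farApart a b then b ∷ a ∷ r else a ∷ b ∷ r
swapAt zero r = r
swapAt (suc p) [] = []
swapAt (suc p) (x ∷ r) = x ∷ swapAt p r

braidAt : ℕ → Word → Word
braidAt zero (a ∷ b ∷ c ∷ r) = if a ≡ᵇ c then b ∷ a ∷ b ∷ r else a ∷ b ∷ c ∷ r
braidAt zero r = r
braidAt (suc p) [] = []
braidAt (suc p) (x ∷ r) = x ∷ braidAt p r

-- 𝔠_j : swaps ρ_j, ρ_{j+1} (left positions m−j−1, m−j) if |ρ_j − ρ_{j+1}| > 1
cMove : ℕ → Word → Word
cMove j ρ = swapAt (length ρ ∸ suc j) ρ

-- 𝔟_j : replaces ρ_{j+1} ρ_j ρ_{j−1} by ρ_j ρ_{j+1} ρ_j if ρ_{j+1} = ρ_{j−1}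
bMove : ℕ → Word → Word
bMove j ρ = braidAt (length ρ ∸ suc j) ρ

dMove : ℕ → Word → Word
dMove i ρ =
  if (a ≡ᵇ c) ∧ ((a ≡ᵇ suc b) ∨ (suc a ≡ᵇ b)) then bMove i ρ
  else if ((b <ᵇ a) ∧ (a <ᵇ c)) ∨ ((c <ᵇ a) ∧ (a <ᵇ b)) then cMove (i ∸ 1) ρ
  else if ((b <ᵇ c) ∧ (c <ᵇ a)) ∨ ((a <ᵇ c) ∧ (c <ᵇ b)) then cMove i ρ
  else ρ
  where
  a = letter ρ (suc i)
  b = letter ρ i
  c = letter ρ (i ∸ 1)

CKStep : Word → Word → Set
CKStep ρ ρ' = Σ ℕ λ i → (1 < i) × (i < length ρ) × (ρ' ≡ dMove i ρ)

_≈CK_ : Word → Word → Set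
_≈CK_ = EqClosure CKStep

-- drop alignment: each letter of τ (a column) together with the letter of σ
-- below it (if any), and the letters of σ placed right of column t.
align : Word → Word → List (ℕ × Maybe ℕ) × Word
align [] σ = [] , σ
align (t ∷ ts) [] = map (λ x → x , nothing) (t ∷ ts) , []
align (t ∷ ts) (s ∷ ss) with s <ᵇ t
... | true  = let r = align ts ss in ((t , just s) ∷ proj₁ r) , proj₂ r
... | false = let r = align ts (s ∷ ss) in ((t , nothing) ∷ proj₁ r) , proj₂ r

-- split the columns at the letters x_1,…,x_k with nothing below them:
-- returns (τ^{(0)} paired with σ^{(0)},  [(x_1, τ^{(1)} paired with σ^{(1)}), …])
segments : List (ℕ × Maybe ℕ) → List (ℕ × ℕ) × List (ℕ × List (ℕ × ℕ))
segments [] = [] , []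
segments ((t , just s) ∷ r) = let q = segments r in ((t , s) ∷ proj₁ q) , proj₂ q
segments ((t , nothing) ∷ r) = let q = segments r in [] , ((t , proj₁ q) ∷ proj₂ q)

bump : ℕ → ℕ → List (ℕ × ℕ) → List ℕ
bump s1 i [] = []
bump s1 i ((t , s) ∷ r) =
  if t ≡ᵇ s1 + i then suc s ∷ bump s1 (suc i) r else map proj₂ ((t , s) ∷ r)

hatSeg : ℕ → List (ℕ × ℕ) → List ℕ
hatSeg x [] = []
hatSeg x ((t1 , s1) ∷ r) =
  if x ≡ᵇ t1 ∸ 1 then bump s1 1 ((t1 , s1) ∷ r) else map proj₂ ((t1 , s1) ∷ r)

-- drop(τσ) = τ^{(0)}⋯τ^{(k)} σ^{(0)} x_1 σ̂^{(1)} ⋯ x_k σ̂^{(k)} σ^{(k+1)}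
dropWord : Word → Word → Word
dropWord τ σ =
  map proj₁ seg0 ++ concatMap (λ p → map proj₁ (proj₂ p)) rest
  ++ map proj₂ seg0 ++ concatMap (λ p → proj₁ p ∷ hatSeg (proj₁ p) (proj₂ p)) rest
  ++ proj₂ al
  where
  al = align τ σ
  seg0 = proj₁ (segments (proj₁ al))
  rest = proj₂ (segments (proj₁ al))

IncreasingPos : Word → Set
IncreasingPos w = Linked _<_ w × All (λ x → 1 ≤ x) w

-- Scan the drop alignment column by column, maintaining a word Coxeter–Knuth equivalent
-- to τσ: the covered letters of τ scanned so far, then the bottom row built so far, then
-- the unscanned letters of τ and σ.  A letter x of τ with nothing below it just joins
-- the bottom row, without changing the word.  A letter s of σ placed below t first
-- moves left past the rest of τ (all larger than t > s), and then t moves left past the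
-- increasing bottom row; each step is a move 𝔡_i swapping two adjacent letters next to
-- a letter lying between them.  If the bottom row ends in s, the word contains s t s, so
-- reducedness forces t = s + 1, and after the braid s (s+1) s ↦ (s+1) s (s+1) it is s + 1
-- that enters the bottom row: this is the bump producing σ̂.  Reducedness itself is kept
-- along the way, since Coxeter–Knuth moves change neither the permutation, nor the
-- length, nor the largest letter.

module Submission where

open import Defs
open import Data.Bool using (Bool; true; false; T; _∧_; _∨_; if_then_else_)
open import Data.Empty using (⊥-elim)
open import Data.List using (List; []; _∷_; _++_; _∷ʳ_; length; map; concatMap; applyUpTo; cartesianProduct)
open import Data.List.Properties using (foldr-++; length-++; ∷ʳ-++; ++-assoc; ++-identityʳ)
open import Data.List.Relation.Unary.All as All using (All; []; _∷_)
import Data.List.Relation.Unary.All.Properties as AllP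
open import Data.List.Relation.Unary.Linked as Linked using (Linked; []; [-]; _∷_)
open import Data.List.Relation.Unary.Linked.Properties using (Linked⇒All; applyUpTo⁺₂)
open import Data.Nat using (ℕ; zero; suc; _+_; _*_; _∸_; _⊔_; _<_; _≤_; _≮_; _≡ᵇ_; _<ᵇ_; z≤n; s≤s)
open import Data.Nat.Properties
open import Data.Maybe using (Maybe; just; nothing)
open import Data.Product using (_×_; _,_; proj₁; proj₂; Σ-syntax)
open import Data.Sum using (_⊎_; inj₁; inj₂)
open import Data.Unit using (⊤; tt)
open import Function using (_∘_)
open import Relation.Binary.Construct.Closure.Equivalence using (gfold; setoid; symmetric; transitive)
import Relation.Binary.Reasoning.Setoid
open import Relation.Binary.Construct.Closure.ReflexiveTransitive using (ε; _◅_)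
open import Relation.Binary.Construct.Closure.Symmetric using (fwd)
open import Relation.Binary.PropositionalEquality
  using (_≡_; _≢_; refl; sym; trans; cong; cong₂; subst; subst₂; _≗_; isEquivalence; module ≡-Reasoning)
open import Relation.Nullary using (¬_; yes; no; Reflects; ofʸ; ofⁿ)
open import Relation.Nullary.Decidable using (proof; dec-true; dec-false; _×-dec_)
open import Algebra.Properties.CommutativeSemigroup ⊔-commutativeSemigroup using (x∙yz≈y∙xz)

≡ᵇ-reflects : ∀ m n → Reflects (m ≡ n) (m ≡ᵇ n)
≡ᵇ-reflects m n = proof (m ≟ n)

≡ᵇ-true : ∀ {m n} → m ≡ n → (m ≡ᵇ n) ≡ true
≡ᵇ-true {m} {n} = dec-true (m ≟ n)

≡ᵇ-false : ∀ {m n} → m ≢ n → (m ≡ᵇ n) ≡ false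
≡ᵇ-false {m} {n} = dec-false (m ≟ n)

<ᵇ-true : ∀ {m n} → m < n → (m <ᵇ n) ≡ true
<ᵇ-true {m} {n} = dec-true (m <? n)

<ᵇ-false : ∀ {m n} → m ≮ n → (m <ᵇ n) ≡ false
<ᵇ-false {m} {n} = dec-false (m <? n)

<ᵇ-sound : ∀ {m n} → (m <ᵇ n) ≡ true → m < n
<ᵇ-sound {m} {n} e = <ᵇ⇒< m n (subst T (sym e) tt)

linked-head-< : ∀ {x xs} → Linked _<_ (x ∷ xs) → All (x <_) xs
linked-head-< [-] = []
linked-head-< (x<y ∷ lk) = Linked⇒All <-trans x<y lk

linked-<-last : ∀ {x U w} → Linked _<_ ((x ∷ U) ∷ʳ w) → x < w
linked-<-last {U = U} lk = All.head (AllP.++⁻ʳ U (linked-head-< lk))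

linked-++⁻ˡ : ∀ V {Q} → Linked _<_ (V ++ Q) → Linked _<_ V
linked-++⁻ˡ [] _ = []
linked-++⁻ˡ (v ∷ []) _ = [-]
linked-++⁻ˡ (v ∷ v′ ∷ V) (v<v′ ∷ lk) = v<v′ ∷ linked-++⁻ˡ (v′ ∷ V) lk

linked-++⁻ʳ : ∀ V {Q} → Linked _<_ (V ++ Q) → Linked _<_ Q
linked-++⁻ʳ [] lk = lk
linked-++⁻ʳ (v ∷ V) lk = linked-++⁻ʳ V (Linked.tail lk)

linked-join : ∀ V {x Q} → Linked _<_ (V ∷ʳ x) → Linked _<_ (x ∷ Q) → Linked _<_ (V ++ x ∷ Q)
linked-join [] _ lk = lk
linked-join (v ∷ []) (v<x ∷ _) lk = v<x ∷ lk
linked-join (v ∷ v′ ∷ V) (v<v′ ∷ lk′) lk = v<v′ ∷ linked-join (v′ ∷ V) lk′ lk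

linked-∷ʳ : ∀ V {x y} → Linked _<_ (V ∷ʳ x) → x < y → Linked _<_ ((V ∷ʳ x) ∷ʳ y)
linked-∷ʳ V {x} {y} lk x<y = subst (Linked _<_) (sym (∷ʳ-++ V x (y ∷ []))) (linked-join V lk (x<y ∷ [-]))

linked-lower : ∀ {s t Q} → s < t → Linked _<_ (t ∷ Q) → Linked _<_ (s ∷ Q)
linked-lower s<t [-] = [-]
linked-lower s<t (t<q ∷ lk) = <-trans s<t t<q ∷ lk

data SwapView (a j : ℕ) : ℕ → Set where
  lower  : j ≡ a → SwapView a j (suc a)
  upper  : j ≡ suc a → SwapView a j a
  fixed  : j ≢ a → j ≢ suc a → SwapView a j j

swapView : ∀ a j → SwapView a j (sTr a j)
swapView a j with j ≡ᵇ a | ≡ᵇ-reflects j a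
... | true  | ofʸ j≡a = lower j≡a
... | false | ofⁿ j≢a with j ≡ᵇ suc a | ≡ᵇ-reflects j (suc a)
...   | true  | ofʸ j≡1+a = upper j≡1+a
...   | false | ofⁿ j≢1+a = fixed j≢a j≢1+a

sTr-suc : ∀ a j → sTr (suc a) (suc j) ≡ suc (sTr a j)
sTr-suc a j with j ≡ᵇ a
... | true = refl
... | false with j ≡ᵇ suc a
...   | true = refl
...   | false = refl

sTr-involutive : ∀ a j → sTr a (sTr a j) ≡ j
sTr-involutive zero zero = refl
sTr-involutive zero (suc zero) = refl
sTr-involutive zero (suc (suc j)) = refl
sTr-involutive (suc a) zero = refl
sTr-involutive (suc a) (suc j)
  rewrite sTr-suc a j | sTr-suc a (sTr a j) = cong suc (sTr-involutive a j)

sTr-comm : ∀ a b j → suc a < b → sTr a (sTr b j) ≡ sTr b (sTr a j)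
sTr-comm zero (suc zero) j (s≤s ())
sTr-comm zero (suc (suc b)) zero _ = refl
sTr-comm zero (suc (suc b)) (suc zero) _ = refl
sTr-comm zero (suc (suc b)) (suc (suc j)) _ rewrite sTr-suc (suc b) (suc j) | sTr-suc b j = refl
sTr-comm (suc a) (suc b) zero _ = refl
sTr-comm (suc a) (suc b) (suc j) (s≤s a+1<b)
  rewrite sTr-suc b j | sTr-suc a j | sTr-suc a (sTr b j) | sTr-suc b (sTr a j)
  = cong suc (sTr-comm a b j a+1<b)

sTr-braid : ∀ a j → sTr a (sTr (suc a) (sTr a j)) ≡ sTr (suc a) (sTr a (sTr (suc a) j))
sTr-braid zero zero = refl
sTr-braid zero (suc zero) = refl
sTr-braid zero (suc (suc zero)) = refl
sTr-braid zero (suc (suc (suc j))) = refl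
sTr-braid (suc a) zero = refl
sTr-braid (suc a) (suc j)
  rewrite sTr-suc a j | sTr-suc (suc a) (sTr a j) | sTr-suc a (sTr (suc a) (sTr a j))
        | sTr-suc (suc a) j | sTr-suc a (sTr (suc a) j) | sTr-suc (suc a) (sTr a (sTr (suc a) j))
  = cong suc (sTr-braid a j)

sTr-reflects-< : ∀ a {u v} → ¬ (u ≡ a × v ≡ suc a) → sTr a v < sTr a u → v < u
sTr-reflects-< a {u} {v} ¬ends lt with sTr a u | swapView a u | sTr a v | swapView a v
... | _ | lower refl | _ | lower refl = ⊥-elim (<-irrefl refl lt)
... | _ | lower refl | _ | upper refl = ⊥-elim (¬ends (refl , refl))
... | _ | lower refl | _ | fixed v≢a _ = ≤∧≢⇒< (≤-pred lt) v≢a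
... | _ | upper refl | _ | lower refl = ⊥-elim (<-asym lt (n<1+n a))
... | _ | upper refl | _ | upper refl = ⊥-elim (<-irrefl refl lt)
... | _ | upper refl | _ | fixed _ _ = <-trans lt (n<1+n a)
... | _ | fixed _ _ | _ | lower refl = ≤-<-trans (n≤1+n a) lt
... | _ | fixed _ u≢1+a | _ | upper refl = ≤∧≢⇒< lt (u≢1+a ∘ sym)
... | _ | fixed _ _ | _ | fixed _ _ = lt

perm-++ : ∀ ρ ρ′ j → perm (ρ ++ ρ′) j ≡ perm ρ (perm ρ′ j)
perm-++ ρ ρ′ j = foldr-++ sTr j ρ ρ′

permInv : Word → ℕ → ℕ
permInv [] j = j
permInv (a ∷ ρ) j = permInv ρ (sTr a j)

permInv-perm : ∀ ρ j → permInv ρ (perm ρ j) ≡ j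
permInv-perm [] j = refl
permInv-perm (a ∷ ρ) j rewrite sTr-involutive a (perm ρ j) = permInv-perm ρ j

record _≋_ (ρ ρ′ : Word) : Set where
  field
    perm-≗      : perm ρ ≗ perm ρ′
    maxLetter-≡ : maxLetter ρ ≡ maxLetter ρ′
    length-≡    : length ρ ≡ length ρ′

open _≋_

≋-refl : ∀ {ρ} → ρ ≋ ρ
≋-refl = record { perm-≗ = λ _ → refl ; maxLetter-≡ = refl ; length-≡ = refl }

≋-sym : ∀ {ρ ρ′} → ρ ≋ ρ′ → ρ′ ≋ ρ
≋-sym e = record
  { perm-≗ = sym ∘ perm-≗ e ; maxLetter-≡ = sym (maxLetter-≡ e) ; length-≡ = sym (length-≡ e) }

∷-≋ : ∀ x {ρ ρ′} → ρ ≋ ρ′ → (x ∷ ρ) ≋ (x ∷ ρ′)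
∷-≋ x e = record
  { perm-≗      = cong (sTr x) ∘ perm-≗ e
  ; maxLetter-≡ = cong (x ⊔_) (maxLetter-≡ e)
  ; length-≡    = cong suc (length-≡ e)
  }

commute-≋ : ∀ a b r → suc a < b ⊎ suc b < a → (b ∷ a ∷ r) ≋ (a ∷ b ∷ r)
commute-≋ a b r far = record
  { perm-≗      = λ j → commute (perm r j) far
  ; maxLetter-≡ = x∙yz≈y∙xz b a (maxLetter r)
  ; length-≡    = refl
  }
  where
  commute : ∀ j → suc a < b ⊎ suc b < a → sTr b (sTr a j) ≡ sTr a (sTr b j)
  commute j (inj₁ a+1<b) = sym (sTr-comm a b j a+1<b)
  commute j (inj₂ b+1<a) = sTr-comm b a j b+1<a

m⊔[m⊔n]≡m⊔n : ∀ m n → m ⊔ (m ⊔ n) ≡ m ⊔ n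
m⊔[m⊔n]≡m⊔n m n = trans (sym (⊔-assoc m m n)) (cong (_⊔ n) (⊔-idem m))

braid-≋ : ∀ a r → (suc a ∷ a ∷ suc a ∷ r) ≋ (a ∷ suc a ∷ a ∷ r)
braid-≋ a r = record
  { perm-≗      = λ j → sym (sTr-braid a (perm r j))
  ; maxLetter-≡ = begin
      suc a ⊔ (a ⊔ (suc a ⊔ m)) ≡⟨ cong (suc a ⊔_) (x∙yz≈y∙xz a (suc a) m) ⟩
      suc a ⊔ (suc a ⊔ (a ⊔ m)) ≡⟨ m⊔[m⊔n]≡m⊔n (suc a) (a ⊔ m) ⟩
      suc a ⊔ (a ⊔ m)           ≡⟨ x∙yz≈y∙xz (suc a) a m ⟩
      a ⊔ (suc a ⊔ m)           ≡⟨ m⊔[m⊔n]≡m⊔n a (suc a ⊔ m) ⟨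
      a ⊔ (a ⊔ (suc a ⊔ m))     ≡⟨ cong (a ⊔_) (x∙yz≈y∙xz a (suc a) m) ⟩
      a ⊔ (suc a ⊔ (a ⊔ m))     ∎
  ; length-≡    = refl
  }
  where
  open ≡-Reasoning
  m : ℕ
  m = maxLetter r

countTrue-++ : ∀ {A : Set} (f : A → Bool) xs ys →
  countTrue f (xs ++ ys) ≡ countTrue f xs + countTrue f ys
countTrue-++ f [] ys = refl
countTrue-++ f (x ∷ xs) ys with f x
... | true  = cong suc (countTrue-++ f xs ys)
... | false = countTrue-++ f xs ys

countTrue-map : ∀ {A B : Set} (f : B → Bool) (g : A → B) xs →
  countTrue f (map g xs) ≡ countTrue (f ∘ g) xs
countTrue-map f g [] = refl
countTrue-map f g (x ∷ xs) with f (g x)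
... | true  = cong suc (countTrue-map f g xs)
... | false = countTrue-map f g xs

countTrue-cong : ∀ {A : Set} {f g : A → Bool} → f ≗ g → ∀ xs → countTrue f xs ≡ countTrue g xs
countTrue-cong f≗g [] = refl
countTrue-cong {f = f} {g} f≗g (x ∷ xs) with f x | g x | f≗g x
... | true  | true  | refl = cong suc (countTrue-cong f≗g xs)
... | false | false | refl = countTrue-cong f≗g xs

countTrue-none : ∀ {A : Set} (f : A → Bool) {xs} → All (λ x → f x ≡ false) xs → countTrue f xs ≡ 0
countTrue-none f [] = refl
countTrue-none f {x ∷ _} (fx≡false ∷ rest) rewrite fx≡false = countTrue-none f rest

countTrue-≤-+ : ∀ {A : Set} {f g h : A → Bool} → (∀ x → f x ≡ true → g x ≡ true ⊎ h x ≡ true) →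
  ∀ xs → countTrue f xs ≤ countTrue g xs + countTrue h xs
countTrue-≤-+ split [] = z≤n
countTrue-≤-+ {f = f} {g} {h} split (x ∷ xs) with f x | g x | h x | split x | countTrue-≤-+ split xs
... | false | false | false | _ | ih = ih
... | false | false | true  | _ | ih = ≤-trans ih (+-monoʳ-≤ _ (n≤1+n _))
... | false | true  | false | _ | ih = m≤n⇒m≤1+n ih
... | false | true  | true  | _ | ih = m≤n⇒m≤1+n (≤-trans ih (+-monoʳ-≤ _ (n≤1+n _)))
... | true  | false | false | split′ | _ with split′ refl
...   | inj₁ ()
...   | inj₂ ()
countTrue-≤-+ split (x ∷ xs) | true | false | true  | _ | ih = ≤-trans (s≤s ih) (≤-reflexive (sym (+-suc _ _)))
countTrue-≤-+ split (x ∷ xs) | true | true  | false | _ | ih = s≤s ih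
countTrue-≤-+ split (x ∷ xs) | true | true  | true  | _ | ih = s≤s (≤-trans ih (+-monoʳ-≤ _ (n≤1+n _)))

isPair : ℕ → ℕ → ℕ × ℕ → Bool
isPair c d p = (proj₁ p ≡ᵇ c) ∧ (proj₂ p ≡ᵇ d)

countTrue-isPair : ∀ c d xs ys →
  countTrue (isPair c d) (cartesianProduct xs ys)
    ≡ countTrue (_≡ᵇ c) xs * countTrue (_≡ᵇ d) ys
countTrue-isPair c d [] ys = refl
countTrue-isPair c d (x ∷ xs) ys = begin
  countTrue (isPair c d) (map (x ,_) ys ++ cartesianProduct xs ys)
    ≡⟨ countTrue-++ (isPair c d) (map (x ,_) ys) (cartesianProduct xs ys) ⟩
  countTrue (isPair c d) (map (x ,_) ys) + countTrue (isPair c d) (cartesianProduct xs ys)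
    ≡⟨ cong₂ _+_ (countTrue-map (isPair c d) (x ,_) ys) (countTrue-isPair c d xs ys) ⟩
  countTrue (λ y → (x ≡ᵇ c) ∧ (y ≡ᵇ d)) ys + countTrue (_≡ᵇ c) xs * countTrue (_≡ᵇ d) ys
    ≡⟨ row (x ≡ᵇ c) ⟩
  countTrue (_≡ᵇ c) (x ∷ xs) * countTrue (_≡ᵇ d) ys ∎
  where
  open ≡-Reasoning
  row : ∀ b → countTrue (λ y → b ∧ (y ≡ᵇ d)) ys + countTrue (_≡ᵇ c) xs * countTrue (_≡ᵇ d) ys
            ≡ (if b then suc (countTrue (_≡ᵇ c) xs) else countTrue (_≡ᵇ c) xs) * countTrue (_≡ᵇ d) ys
  row true  = refl
  row false = cong (_+ countTrue (_≡ᵇ c) xs * countTrue (_≡ᵇ d) ys)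
                   (countTrue-none (λ _ → false) (All.universal (λ _ → refl) ys))

countTrue-≡ᵇ-≤1 : ∀ c {xs} → Linked _<_ xs → countTrue (_≡ᵇ c) xs ≤ 1
countTrue-≡ᵇ-≤1 c {[]} _ = z≤n
countTrue-≡ᵇ-≤1 c {x ∷ xs} lk with x ≡ᵇ c | ≡ᵇ-reflects x c
... | true  | ofʸ refl =
  s≤s (≤-reflexive (countTrue-none (_≡ᵇ x) (All.map (λ x<y → ≡ᵇ-false (>⇒≢ x<y)) (linked-head-< lk))))
... | false | ofⁿ _    = countTrue-≡ᵇ-≤1 c (Linked.tail lk)

oneTo : ℕ → List ℕ
oneTo N = applyUpTo suc N

oneTo-increasing : ∀ N → Linked _<_ (oneTo N)
oneTo-increasing N = applyUpTo⁺₂ suc N (λ i → n<1+n (suc i))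

isInversion : (ℕ → ℕ) → ℕ × ℕ → Bool
isInversion f p = (proj₁ p <ᵇ proj₂ p) ∧ (f (proj₂ p) <ᵇ f (proj₁ p))

-- inversions ρ unfolds to inversionsBelow (suc (maxLetter ρ)) (perm ρ).
inversionsBelow : ℕ → (ℕ → ℕ) → ℕ
inversionsBelow N f = countTrue (isInversion f) (cartesianProduct (oneTo N) (oneTo N))

inversionsBelow-cong : ∀ N {f g} → f ≗ g → inversionsBelow N f ≡ inversionsBelow N g
inversionsBelow-cong N f≗g = countTrue-cong
  (λ p → cong₂ (λ u v → (proj₁ p <ᵇ proj₂ p) ∧ (u <ᵇ v)) (f≗g (proj₂ p)) (f≗g (proj₁ p)))
  (cartesianProduct (oneTo N) (oneTo N))

≋-inversions : ∀ {ρ ρ′} → ρ ≋ ρ′ → inversions ρ ≡ inversions ρ′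
≋-inversions {ρ} {ρ′} e = begin
  inversionsBelow (suc (maxLetter ρ)) (perm ρ)
    ≡⟨ cong (λ m → inversionsBelow (suc m) (perm ρ)) (maxLetter-≡ e) ⟩
  inversionsBelow (suc (maxLetter ρ′)) (perm ρ)
    ≡⟨ inversionsBelow-cong (suc (maxLetter ρ′)) (perm-≗ e) ⟩
  inversionsBelow (suc (maxLetter ρ′)) (perm ρ′) ∎
  where open ≡-Reasoning

isInversion-sTr : ∀ a f g → (∀ i → g (f i) ≡ i) → ∀ p → isInversion (sTr a ∘ f) p ≡ true →
  isInversion f p ≡ true ⊎ isPair (g a) (g (suc a)) p ≡ true
isInversion-sTr a f g gf (i , j) inv with i <ᵇ j
isInversion-sTr a f g gf (i , j) () | false
... | true with (f i ≟ a) ×-dec (f j ≟ suc a)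
...   | yes (fi≡a , fj≡1+a) =
        inj₂ (cong₂ _∧_ (≡ᵇ-true (trans (sym (gf i)) (cong g fi≡a)))
                        (≡ᵇ-true (trans (sym (gf j)) (cong g fj≡1+a))))
...   | no ¬ends = inj₁ (<ᵇ-true (sTr-reflects-< a ¬ends (<ᵇ-sound inv)))

inversionsBelow-∷ : ∀ N a ρ → inversionsBelow N (perm (a ∷ ρ)) ≤ suc (inversionsBelow N (perm ρ))
inversionsBelow-∷ N a ρ = begin
  inversionsBelow N (perm (a ∷ ρ))
    ≤⟨ countTrue-≤-+ (isInversion-sTr a (perm ρ) (permInv ρ) (permInv-perm ρ)) (cartesianProduct range range) ⟩
  inversionsBelow N (perm ρ) + countTrue (isPair (permInv ρ a) (permInv ρ (suc a)))
                                         (cartesianProduct range range)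
    ≡⟨ cong (inversionsBelow N (perm ρ) +_) (countTrue-isPair _ _ range range) ⟩
  inversionsBelow N (perm ρ) + countTrue (_≡ᵇ permInv ρ a) range * countTrue (_≡ᵇ permInv ρ (suc a)) range
    ≤⟨ +-monoʳ-≤ _ (*-mono-≤ (countTrue-≡ᵇ-≤1 _ (oneTo-increasing N))
                             (countTrue-≡ᵇ-≤1 _ (oneTo-increasing N))) ⟩
  inversionsBelow N (perm ρ) + 1
    ≡⟨ +-comm _ 1 ⟩
  suc (inversionsBelow N (perm ρ)) ∎
  where
  open ≤-Reasoning
  range : List ℕ
  range = oneTo N

<ᵇ-asym : ∀ i j → ((i <ᵇ j) ∧ (j <ᵇ i)) ≡ false
<ᵇ-asym i j with i <ᵇ j | <ᵇ-reflects-< i j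
... | false | _       = refl
... | true  | ofʸ i<j = <ᵇ-false (<⇒≯ i<j)

inversionsBelow≤length : ∀ N ρ → inversionsBelow N (perm ρ) ≤ length ρ
inversionsBelow≤length N [] = ≤-reflexive (countTrue-none (isInversion (perm []))
  (All.universal (λ p → <ᵇ-asym (proj₁ p) (proj₂ p)) (cartesianProduct (oneTo N) (oneTo N))))
inversionsBelow≤length N (a ∷ ρ) = ≤-trans (inversionsBelow-∷ N a ρ) (s≤s (inversionsBelow≤length N ρ))

-- Coxeter–Knuth moves preserve reducedness

swapAt-≋ : ∀ p ρ → swapAt p ρ ≋ ρ
swapAt-≋ zero [] = ≋-refl
swapAt-≋ zero (a ∷ []) = ≋-refl
swapAt-≋ zero (a ∷ b ∷ r) with suc a <ᵇ b | <ᵇ-reflects-< (suc a) b | suc b <ᵇ a | <ᵇ-reflects-< (suc b) a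
... | true  | ofʸ a+1<b | _     | _         = commute-≋ a b r (inj₁ a+1<b)
... | false | _         | true  | ofʸ b+1<a = commute-≋ a b r (inj₂ b+1<a)
... | false | _         | false | _         = ≋-refl
swapAt-≋ (suc p) [] = ≋-refl
swapAt-≋ (suc p) (x ∷ ρ) = ∷-≋ x (swapAt-≋ p ρ)

braidCondition : ℕ → ℕ → ℕ → Bool
braidCondition a b c = (a ≡ᵇ c) ∧ ((a ≡ᵇ suc b) ∨ (suc a ≡ᵇ b))

braidAt-≋ : ∀ p ρ → braidCondition (nthL ρ p) (nthL ρ (suc p)) (nthL ρ (suc (suc p))) ≡ true →
  braidAt p ρ ≋ ρ
braidAt-≋ zero [] _ = ≋-refl
braidAt-≋ zero (a ∷ []) _ = ≋-refl
braidAt-≋ zero (a ∷ b ∷ []) _ = ≋-refl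
braidAt-≋ zero (a ∷ b ∷ c ∷ r) cond
  with a ≡ᵇ c | ≡ᵇ-reflects a c | a ≡ᵇ suc b | ≡ᵇ-reflects a (suc b) | suc a ≡ᵇ b | ≡ᵇ-reflects (suc a) b
... | true | ofʸ refl | true  | ofʸ refl | _    | _        = ≋-sym (braid-≋ b r)
... | true | ofʸ refl | false | _        | true | ofʸ refl = braid-≋ a r
braidAt-≋ zero (a ∷ b ∷ c ∷ r) () | true | _ | false | _ | false | _
braidAt-≋ zero (a ∷ b ∷ c ∷ r) () | false | _ | _ | _ | _ | _
braidAt-≋ (suc p) [] _ = ≋-refl
braidAt-≋ (suc p) (x ∷ ρ) cond = ∷-≋ x (braidAt-≋ p ρ cond)

-- dMove i ρ unfolds to dChoice (letter ρ (suc i)) (letter ρ i) (letter ρ (i ∸ 1))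
-- (bMove i ρ) (cMove (i ∸ 1) ρ) (cMove i ρ) ρ.
dChoice : (a b c : ℕ) (braided swappedBelow swappedAbove unchanged : Word) → Word
dChoice a b c w₁ w₂ w₃ w₄ =
  if braidCondition a b c then w₁
  else if ((b <ᵇ a) ∧ (a <ᵇ c)) ∨ ((c <ᵇ a) ∧ (a <ᵇ b)) then w₂
  else if ((b <ᵇ c) ∧ (c <ᵇ a)) ∨ ((a <ᵇ c) ∧ (c <ᵇ b)) then w₃
  else w₄

dChoice-cong : ∀ {a a′ b b′ c c′ w₁ w₁′ w₂ w₂′ w₃ w₃′} w₄ →
  a ≡ a′ → b ≡ b′ → c ≡ c′ → w₁ ≡ w₁′ → w₂ ≡ w₂′ → w₃ ≡ w₃′ →
  dChoice a b c w₁ w₂ w₃ w₄ ≡ dChoice a′ b′ c′ w₁′ w₂′ w₃′ w₄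
dChoice-cong _ refl refl refl refl refl refl = refl

if-elim : ∀ (P : Word → Set) b {x y} → P x → P y → P (if b then x else y)
if-elim P true  px _  = px
if-elim P false _  py = py

dChoice-elim : ∀ (P : Word → Set) a b c {w₁ w₂ w₃ w₄} →
  (braidCondition a b c ≡ true → P w₁) → P w₂ → P w₃ → P w₄ → P (dChoice a b c w₁ w₂ w₃ w₄)
dChoice-elim P a b c p₁ p₂ p₃ p₄ with braidCondition a b c
... | true  = p₁ refl
... | false = if-elim P (((b <ᵇ a) ∧ (a <ᵇ c)) ∨ ((c <ᵇ a) ∧ (a <ᵇ b))) p₂
                (if-elim P (((b <ᵇ c) ∧ (c <ᵇ a)) ∨ ((a <ᵇ c) ∧ (c <ᵇ b))) p₃ p₄)

dMove-≋ : ∀ i ρ → suc i < length ρ → dMove (suc i) ρ ≋ ρ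
dMove-≋ i ρ i<len = dChoice-elim (_≋ ρ) (letter ρ (suc (suc i))) (letter ρ (suc i)) (letter ρ i)
  braid (swapAt-≋ (length ρ ∸ suc i) ρ) (swapAt-≋ p ρ) ≋-refl
  where
  p : ℕ
  p = length ρ ∸ suc (suc i)
  index₁ : length ρ ∸ suc i ≡ suc p
  index₁ = +-∸-assoc 1 i<len
  index₂ : length ρ ∸ i ≡ suc (suc p)
  index₂ = trans (+-∸-assoc 1 (<⇒≤ i<len)) (cong suc index₁)
  braid : braidCondition (letter ρ (suc (suc i))) (letter ρ (suc i)) (letter ρ i) ≡ true → braidAt p ρ ≋ ρ
  braid cond = braidAt-≋ p ρ
    (subst₂ (λ m n → braidCondition (nthL ρ p) (nthL ρ m) (nthL ρ n) ≡ true) index₁ index₂ cond)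

ckStep-≋ : ∀ {ρ ρ′} → CKStep ρ ρ′ → ρ′ ≋ ρ
ckStep-≋ {ρ} (suc i , _ , i<len , refl) = dMove-≋ i ρ i<len

≈CK-inversions-length : ∀ {ρ ρ′} → ρ ≈CK ρ′ → (inversions ρ , length ρ) ≡ (inversions ρ′ , length ρ′)
≈CK-inversions-length = gfold isEquivalence (λ ρ → inversions ρ , length ρ)
  (λ {ρ} {ρ′} step → let ρ′≋ρ = ckStep-≋ {ρ} {ρ′} step in
    sym (cong₂ _,_ (≋-inversions ρ′≋ρ) (length-≡ ρ′≋ρ)))

≈CK-reduced : ∀ {ρ ρ′} → ρ ≈CK ρ′ → Reduced ρ → Reduced ρ′
≈CK-reduced {ρ} {ρ′} ρ≈ρ′ red = trans (sym (cong proj₁ stats)) (trans red (cong proj₂ stats))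
  where
  stats : (inversions ρ , length ρ) ≡ (inversions ρ′ , length ρ′)
  stats = ≈CK-inversions-length ρ≈ρ′

-- a b a with |a − b| > 1 represents s_b with two extra letters.
¬reduced-far-aba : ∀ p q a b → suc a < b ⊎ suc b < a → ¬ Reduced (p ++ a ∷ b ∷ a ∷ q)
¬reduced-far-aba p q a b far red = <-irrefl refl (begin-strict
  length ρ                     ≡⟨ sym red ⟩
  inversionsBelow N (perm ρ)   ≡⟨ inversionsBelow-cong N same-perm ⟩
  inversionsBelow N (perm ρ′)  ≤⟨ inversionsBelow≤length N ρ′ ⟩
  length ρ′                    <⟨ shorter ⟩
  length ρ                     ∎)
  where
  open ≤-Reasoning
  ρ ρ′ : Word
  ρ = p ++ a ∷ b ∷ a ∷ q
  ρ′ = p ++ b ∷ q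
  N : ℕ
  N = suc (maxLetter ρ)
  same-perm : perm ρ ≗ perm ρ′
  same-perm j rewrite perm-++ p (a ∷ b ∷ a ∷ q) j | perm-++ p (b ∷ q) j = cong (perm p)
    (trans (sym (perm-≗ (commute-≋ a b (a ∷ q) far) j)) (cong (sTr b) (sTr-involutive a (perm q j))))
  shorter : length ρ′ < length ρ
  shorter rewrite length-++ p {b ∷ q} | length-++ p {a ∷ b ∷ a ∷ q} = +-monoʳ-< (length p) (n≤1+n _)

nthL-++ : ∀ p r k → nthL (p ++ r) (length p + k) ≡ nthL r k
nthL-++ [] r k = refl
nthL-++ (x ∷ p) r k = nthL-++ p r k

swapAt-++ : ∀ p r k → swapAt (length p + k) (p ++ r) ≡ p ++ swapAt k r
swapAt-++ [] r k = refl
swapAt-++ (x ∷ p) r k = cong (x ∷_) (swapAt-++ p r k)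

braidAt-++ : ∀ p r k → braidAt (length p + k) (p ++ r) ≡ p ++ braidAt k r
braidAt-++ [] r k = refl
braidAt-++ (x ∷ p) r k = cong (x ∷_) (braidAt-++ p r k)

∸-offset : ∀ m k n → (m + (k + n)) ∸ n ≡ m + k
∸-offset m k n = trans (cong (_∸ n) (sym (+-assoc m k n))) (m+n∸n≡m (m + k) n)

module _ (p q : Word) {a b c : ℕ} where

  -- equals dMove (2 + length q) (p ++ a ∷ b ∷ c ∷ q)
  windowMove : Word
  windowMove = dChoice a b c (p ++ braidAt 0 (a ∷ b ∷ c ∷ q)) (p ++ a ∷ swapAt 0 (b ∷ c ∷ q))
                             (p ++ swapAt 0 (a ∷ b ∷ c ∷ q)) (p ++ a ∷ b ∷ c ∷ q)

  private
    w : Word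
    w = p ++ a ∷ b ∷ c ∷ q

    position : ∀ k m → k + m ≡ 3 + length q → length w ∸ m ≡ length p + k
    position k m e =
      trans (cong (_∸ m) (trans (length-++ p) (cong (length p +_) (sym e)))) (∸-offset (length p) k m)

    letterAt : ∀ k m → k + m ≡ 3 + length q → letter w m ≡ nthL (a ∷ b ∷ c ∷ q) k
    letterAt k m e = trans (cong (nthL w) (position k m e)) (nthL-++ p _ k)

    dMove-window : dMove (2 + length q) w ≡ windowMove
    dMove-window = dChoice-cong w
      (letterAt 0 (3 + length q) refl) (letterAt 1 (2 + length q) refl) (letterAt 2 (1 + length q) refl)
      (trans (cong (λ k → braidAt k w) (position 0 (3 + length q) refl)) (braidAt-++ p _ 0))
      (trans (cong (λ k → swapAt k w) (position 1 (2 + length q) refl)) (swapAt-++ p _ 1))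
      (trans (cong (λ k → swapAt k w) (position 0 (3 + length q) refl)) (swapAt-++ p _ 0))

  ≈CK-window : ∀ {r} → windowMove ≡ r → (p ++ a ∷ b ∷ c ∷ q) ≈CK r
  ≈CK-window e = fwd (2 + length q , s≤s (s≤s z≤n) , inside , sym (trans dMove-window e)) ◅ ε
    where
    inside : 2 + length q < length w
    inside = subst (2 + length q <_) (sym (length-++ p)) (m≤n+m (3 + length q) (length p))

  ck-swap₂₃ : c < a → a < b → (p ++ a ∷ b ∷ c ∷ q) ≈CK (p ++ a ∷ c ∷ b ∷ q)
  ck-swap₂₃ c<a a<b = ≈CK-window choice
    where
    choice : windowMove ≡ p ++ a ∷ c ∷ b ∷ q
    choice rewrite ≡ᵇ-false (>⇒≢ c<a) | <ᵇ-false (<⇒≯ a<b) | <ᵇ-true c<a | <ᵇ-true a<b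
                 | <ᵇ-false (<⇒≯ (<-trans (<-trans c<a a<b) (n<1+n b))) | <ᵇ-true (<-≤-trans (s≤s c<a) a<b) = refl

  ck-swap₁₂ : a < c → c < b → (p ++ a ∷ b ∷ c ∷ q) ≈CK (p ++ b ∷ a ∷ c ∷ q)
  ck-swap₁₂ a<c c<b = ≈CK-window choice
    where
    choice : windowMove ≡ p ++ b ∷ a ∷ c ∷ q
    choice rewrite ≡ᵇ-false (<⇒≢ a<c) | <ᵇ-false (<⇒≯ (<-trans a<c c<b)) | <ᵇ-false (<⇒≯ a<c)
                 | <ᵇ-false (<⇒≯ c<b) | <ᵇ-true a<c | <ᵇ-true c<b | <ᵇ-true (<-≤-trans (s≤s a<c) c<b) = refl

ck-braid : ∀ p q a → (p ++ a ∷ suc a ∷ a ∷ q) ≈CK (p ++ suc a ∷ a ∷ suc a ∷ q)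
ck-braid p q a = ≈CK-window p q choice
  where
  choice : windowMove p q {a} {suc a} {a} ≡ p ++ suc a ∷ a ∷ suc a ∷ q
  choice rewrite ≡ᵇ-true {a} refl | ≡ᵇ-false (<⇒≢ (<-trans (n<1+n a) (n<1+n (suc a)))) = refl

module CK-Reasoning = Relation.Binary.Reasoning.Setoid (setoid CKStep)

pull-below-run : ∀ p t Q s r → Linked _<_ (t ∷ Q) → s < t → (p ++ t ∷ Q ++ s ∷ r) ≈CK (p ++ t ∷ s ∷ Q ++ r)
pull-below-run p t [] s r _ _ = ε
pull-below-run p t (q ∷ Q) s r (t<q ∷ lk) s<t = begin
  p ++ t ∷ q ∷ Q ++ s ∷ r     ≡⟨ ∷ʳ-++ p t _ ⟨
  (p ∷ʳ t) ++ q ∷ Q ++ s ∷ r  ≈⟨ pull-below-run (p ∷ʳ t) q Q s r lk (<-trans s<t t<q) ⟩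
  (p ∷ʳ t) ++ q ∷ s ∷ Q ++ r  ≡⟨ ∷ʳ-++ p t _ ⟩
  p ++ t ∷ q ∷ s ∷ Q ++ r     ≈⟨ ck-swap₂₃ p (Q ++ r) s<t t<q ⟩
  p ++ t ∷ s ∷ q ∷ Q ++ r     ∎
  where open CK-Reasoning

pull-above-run : ∀ p U w t r → Linked _<_ (U ∷ʳ w) → w < t → (p ++ U ++ t ∷ w ∷ r) ≈CK (p ++ t ∷ U ++ w ∷ r)
pull-above-run p [] w t r _ _ = ε
pull-above-run p (u ∷ U) w t r lk w<t = begin
  p ++ (u ∷ U) ++ t ∷ w ∷ r   ≡⟨ ∷ʳ-++ p u _ ⟨
  (p ∷ʳ u) ++ U ++ t ∷ w ∷ r  ≈⟨ pull-above-run (p ∷ʳ u) U w t r (Linked.tail lk) w<t ⟩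
  (p ∷ʳ u) ++ t ∷ U ++ w ∷ r  ≡⟨ ∷ʳ-++ p u _ ⟩
  p ++ u ∷ t ∷ U ++ w ∷ r     ≈⟨ swap-front U lk ⟩
  p ++ t ∷ u ∷ U ++ w ∷ r     ∎
  where
  open CK-Reasoning
  swap-front : ∀ U → Linked _<_ ((u ∷ U) ∷ʳ w) → (p ++ u ∷ t ∷ U ++ w ∷ r) ≈CK (p ++ t ∷ u ∷ U ++ w ∷ r)
  swap-front [] (u<w ∷ _) = ck-swap₁₂ p r u<w w<t
  swap-front (x ∷ U) (u<x ∷ lk′) = ck-swap₁₂ p (U ++ w ∷ r) u<x (<-trans (linked-<-last lk′) w<t)

-- drop, column by column

-- The state of the scan producing the bottom row σ^{(0)} x₁ σ̂^{(1)} ⋯ x_k σ̂^{(k)}: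
-- gap x follows a letter x of τ with nothing below it, and bumping s₁ i is inside
-- the bumped part of σ̂^{(j)}, whose first letter is s₁, at index i.
data Mode : Set where
  copy    : Mode
  gap     : ℕ → Mode
  bumping : ℕ → ℕ → Mode

emit : Mode → ℕ → ℕ → ℕ × Mode
emit copy t s = s , copy
emit (gap x) t s =
  if x ≡ᵇ t ∸ 1 then (if t ≡ᵇ s + 1 then (suc s , bumping s 2) else (s , copy)) else (s , copy)
emit (bumping s₁ i) t s = if t ≡ᵇ s₁ + i then (suc s , bumping s₁ (suc i)) else (s , copy)

Column : Set
Column = ℕ × Maybe ℕ

bottomRow : Mode → List Column → List ℕ
bottomRow m [] = []
bottomRow m ((t , nothing) ∷ cs) = t ∷ bottomRow (gap t) cs
bottomRow m ((t , just s) ∷ cs) = proj₁ (emit m t s) ∷ bottomRow (proj₂ (emit m t s)) cs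

coveredTop : List Column → List ℕ
coveredTop [] = []
coveredTop ((t , nothing) ∷ cs) = coveredTop cs
coveredTop ((t , just s) ∷ cs) = t ∷ coveredTop cs

filled : List (ℕ × ℕ) → List Column
filled = map (λ p → proj₁ p , just (proj₂ p))

bottomRow-copy : ∀ seg → bottomRow copy (filled seg) ≡ map proj₂ seg
bottomRow-copy [] = refl
bottomRow-copy ((t , s) ∷ seg) = cong (s ∷_) (bottomRow-copy seg)

bottomRow-bumping : ∀ s₁ i seg → bottomRow (bumping s₁ i) (filled seg) ≡ bump s₁ i seg
bottomRow-bumping s₁ i [] = refl
bottomRow-bumping s₁ i ((t , s) ∷ seg) with t ≡ᵇ s₁ + i
... | true  = cong (suc s ∷_) (bottomRow-bumping s₁ (suc i) seg)
... | false = cong (s ∷_) (bottomRow-copy seg)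

bottomRow-gap : ∀ x seg → bottomRow (gap x) (filled seg) ≡ hatSeg x seg
bottomRow-gap x [] = refl
bottomRow-gap x ((t , s) ∷ seg) with x ≡ᵇ t ∸ 1
... | false = cong (s ∷_) (bottomRow-copy seg)
... | true with t ≡ᵇ s + 1
...   | true  = cong (suc s ∷_) (bottomRow-bumping s 2 seg)
...   | false = cong (s ∷_) (bottomRow-copy seg)

hatted : ℕ × List (ℕ × ℕ) → List ℕ
hatted p = proj₁ p ∷ hatSeg (proj₁ p) (proj₂ p)

bottomRow-segments : ∀ m cs →
  bottomRow m cs ≡ bottomRow m (filled (proj₁ (segments cs))) ++ concatMap hatted (proj₂ (segments cs))
bottomRow-segments m [] = refl
bottomRow-segments m ((t , just s) ∷ cs) = cong (_ ∷_) (bottomRow-segments _ cs)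
bottomRow-segments m ((t , nothing) ∷ cs) = cong (t ∷_) (begin
  bottomRow (gap t) cs
    ≡⟨ bottomRow-segments (gap t) cs ⟩
  bottomRow (gap t) (filled (proj₁ (segments cs))) ++ concatMap hatted (proj₂ (segments cs))
    ≡⟨ cong (_++ concatMap hatted (proj₂ (segments cs))) (bottomRow-gap t (proj₁ (segments cs))) ⟩
  hatSeg t (proj₁ (segments cs)) ++ concatMap hatted (proj₂ (segments cs)) ∎)
  where open ≡-Reasoning

coveredTop-segments : ∀ cs →
  coveredTop cs ≡ map proj₁ (proj₁ (segments cs)) ++ concatMap (map proj₁ ∘ proj₂) (proj₂ (segments cs))
coveredTop-segments [] = refl
coveredTop-segments ((t , just s) ∷ cs) = cong (t ∷_) (coveredTop-segments cs)
coveredTop-segments ((t , nothing) ∷ cs) = coveredTop-segments cs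

-- The output of drop once the columns scanned so far have contributed T to the top part
-- and V to the bottom row, the scan being in mode m, with τ′ and σ′ still to be aligned.
dropFrom : Word → Word → Mode → Word → Word → Word
dropFrom T V m τ′ σ′ = T ++ coveredTop cols ++ V ++ bottomRow m cols ++ proj₂ (align τ′ σ′)
  where
  cols : List Column
  cols = proj₁ (align τ′ σ′)

dropWord-dropFrom : ∀ τ σ → dropWord τ σ ≡ dropFrom [] [] copy τ σ
dropWord-dropFrom τ σ = sym (begin
  coveredTop cols ++ bottomRow copy cols ++ σ₊
    ≡⟨ cong₂ (λ x y → x ++ y ++ σ₊) (coveredTop-segments cols)
             (trans (bottomRow-segments copy cols) (cong (_++ D) (bottomRow-copy seg₀))) ⟩
  (A ++ B) ++ (C ++ D) ++ σ₊  ≡⟨ ++-assoc A B _ ⟩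
  A ++ B ++ (C ++ D) ++ σ₊    ≡⟨ cong (λ z → A ++ B ++ z) (++-assoc C D σ₊) ⟩
  A ++ B ++ C ++ D ++ σ₊      ∎)
  where
  open ≡-Reasoning
  cols : List Column
  cols = proj₁ (align τ σ)
  σ₊ : Word
  σ₊ = proj₂ (align τ σ)
  seg₀ : List (ℕ × ℕ)
  seg₀ = proj₁ (segments cols)
  A B C D : Word
  A = map proj₁ seg₀
  B = concatMap (map proj₁ ∘ proj₂) (proj₂ (segments cols))
  C = map proj₂ seg₀
  D = concatMap hatted (proj₂ (segments cols))

unfilled : List ℕ → List Column
unfilled = map (λ x → x , nothing)

align-[] : ∀ τ → align τ [] ≡ (unfilled τ , [])
align-[] [] = refl
align-[] (t ∷ τ) = refl

coveredTop-unfilled : ∀ τ → coveredTop (unfilled τ) ≡ []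
coveredTop-unfilled [] = refl
coveredTop-unfilled (t ∷ τ) = coveredTop-unfilled τ

bottomRow-unfilled : ∀ m τ → bottomRow m (unfilled τ) ≡ τ
bottomRow-unfilled m [] = refl
bottomRow-unfilled m (t ∷ τ) = cong (t ∷_) (bottomRow-unfilled (gap t) τ)

dropFrom-[]ʳ : ∀ T V m τ′ → dropFrom T V m τ′ [] ≡ T ++ V ++ τ′
dropFrom-[]ʳ T V m τ′
  rewrite align-[] τ′ | coveredTop-unfilled τ′ | bottomRow-unfilled m τ′ | ++-identityʳ τ′ = refl

dropFrom-below : ∀ T V m {t s} τ′ σ′ → s < t →
  dropFrom T V m (t ∷ τ′) (s ∷ σ′) ≡ dropFrom (T ∷ʳ t) (V ∷ʳ proj₁ (emit m t s)) (proj₂ (emit m t s)) τ′ σ′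
dropFrom-below T V m {t} {s} τ′ σ′ s<t rewrite <ᵇ-true s<t =
  sym (trans (∷ʳ-++ T t _) (cong (λ z → T ++ t ∷ coveredTop (proj₁ (align τ′ σ′)) ++ z) (∷ʳ-++ V _ _)))

dropFrom-beside : ∀ T V m {t s} τ′ σ′ → t ≤ s →
  dropFrom T V m (t ∷ τ′) (s ∷ σ′) ≡ dropFrom T (V ∷ʳ t) (gap t) τ′ (s ∷ σ′)
dropFrom-beside T V m {t} {s} τ′ σ′ t≤s rewrite <ᵇ-false (≤⇒≯ t≤s) =
  cong (λ z → T ++ coveredTop (proj₁ (align τ′ (s ∷ σ′))) ++ z) (sym (∷ʳ-++ V t _))

data Ready : Mode → List ℕ → ℕ → Set where
  copy-ready    : ∀ {V s} → Linked _<_ (V ∷ʳ s) → Ready copy V s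
  gap-ready     : ∀ {V x s} → x ≤ s → Ready (gap x) (V ∷ʳ x) s
  bumping-ready : ∀ {V s₁ i L s} → s₁ + i ≡ suc (suc L) → L < s → Ready (bumping s₁ i) (V ∷ʳ suc L) s

ReadyFor : Mode → List ℕ → Word → Set
ReadyFor m V [] = ⊤
ReadyFor m V (s ∷ _) = Ready m V s

data Placement : Mode → List ℕ → ℕ → ℕ → Set where
  below : ∀ {m V t s} → emit m t s ≡ (s , copy) → Linked _<_ (V ∷ʳ s) → Placement m V t s
  braid : ∀ {m V s s₁ i} → emit m (suc s) s ≡ (suc s , bumping s₁ i) → s₁ + i ≡ suc (suc s) →
          Linked _<_ (V ∷ʳ s) → Placement m (V ∷ʳ s) (suc s) s

-- The bottom row ends in s exactly when the scan bumps, unless t > s + 1.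
classify : ∀ {m V t s} → s < t → Linked _<_ V → Ready m V s →
  Placement m V t s ⊎ Σ[ V′ ∈ List ℕ ] V ≡ V′ ∷ʳ s × suc s < t
classify s<t lkV (copy-ready lk) = inj₁ (below refl lk)
classify {t = t} {s} s<t lkV (gap-ready {V} {x} x≤s) with x ≟ s
... | no x≢s = inj₁ (below emits (linked-∷ʳ V lkV (≤∧≢⇒< x≤s x≢s)))
  where
  x≢t-1 : x ≢ t ∸ 1
  x≢t-1 x≡t-1 = x≢s (≤-antisym x≤s (≤-pred (<-≤-trans s<t t≤1+x)))
    where
    t≤1+x : t ≤ suc x
    t≤1+x = subst (t ≤_) (cong suc (sym x≡t-1)) (m≤n+m∸n t 1)
  emits : emit (gap x) t s ≡ (s , copy)
  emits rewrite ≡ᵇ-false x≢t-1 = refl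
... | yes refl with t ≟ suc s
...   | yes refl = inj₁ (braid emits (+-comm s 2) lkV)
  where
  emits : emit (gap s) (suc s) s ≡ (suc s , bumping s 2)
  emits rewrite ≡ᵇ-true {s} refl | ≡ᵇ-true (+-comm 1 s) = refl
...   | no t≢1+s = inj₂ (V , refl , ≤∧≢⇒< s<t (t≢1+s ∘ sym))
classify {t = t} {s} s<t lkV (bumping-ready {V} {s₁} {i} {L} e L<s) with suc L ≟ s
... | no 1+L≢s = inj₁ (below emits (linked-∷ʳ V lkV (≤∧≢⇒< L<s 1+L≢s)))
  where
  t≢s₁+i : t ≢ s₁ + i
  t≢s₁+i t≡ = 1+L≢s (≤-antisym L<s (≤-pred (subst (s <_) (trans t≡ e) s<t)))
  emits : emit (bumping s₁ i) t s ≡ (s , copy)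
  emits rewrite ≡ᵇ-false t≢s₁+i = refl
... | yes refl with t ≟ suc (suc L)
...   | yes refl = inj₁ (braid emits (trans (+-suc s₁ i) (cong suc e)) lkV)
  where
  emits : emit (bumping s₁ i) (suc (suc L)) (suc L) ≡ (suc (suc L) , bumping s₁ (suc i))
  emits rewrite ≡ᵇ-true (sym e) = refl
...   | no t≢2+L = inj₂ (V , refl , ≤∧≢⇒< s<t (t≢2+L ∘ sym))

placement-≈CK : ∀ {m V t s} → Placement m V t s → s < t → ∀ T X →
  (T ++ V ++ t ∷ s ∷ X) ≈CK (T ++ t ∷ V ++ proj₁ (emit m t s) ∷ X)
placement-≈CK {V = V} {t} {s} (below e lk) s<t T X rewrite e = pull-above-run T V s t X lk s<t
placement-≈CK (braid {V = V} {s} e _ lk) _ T X rewrite e = begin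
  T ++ (V ∷ʳ s) ++ suc s ∷ s ∷ X       ≡⟨ cong (T ++_) (∷ʳ-++ V s _) ⟩
  T ++ V ++ s ∷ suc s ∷ s ∷ X          ≡⟨ ++-assoc T V _ ⟨
  (T ++ V) ++ s ∷ suc s ∷ s ∷ X        ≈⟨ ck-braid (T ++ V) X s ⟩
  (T ++ V) ++ suc s ∷ s ∷ suc s ∷ X    ≡⟨ ++-assoc T V _ ⟩
  T ++ V ++ suc s ∷ s ∷ suc s ∷ X      ≈⟨ pull-above-run T V s (suc s) (suc s ∷ X) lk (n<1+n s) ⟩
  T ++ suc s ∷ V ++ s ∷ suc s ∷ X      ≡⟨ cong (λ z → T ++ suc s ∷ z) (∷ʳ-++ V s _) ⟨
  T ++ suc s ∷ (V ∷ʳ s) ++ suc s ∷ X   ∎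
  where open CK-Reasoning

placement-linked : ∀ {m V t s Q} → Placement m V t s → s < t → Linked _<_ (t ∷ Q) →
  Linked _<_ ((V ∷ʳ proj₁ (emit m t s)) ++ Q)
placement-linked {V = V} {s = s} {Q} (below e lk) s<t lkQ rewrite e =
  subst (Linked _<_) (sym (∷ʳ-++ V s Q)) (linked-join V lk (linked-lower s<t lkQ))
placement-linked {Q = Q} (braid {V = V} {s} e _ lk) _ lkQ rewrite e =
  subst (Linked _<_) (sym (∷ʳ-++ (V ∷ʳ s) (suc s) Q)) (linked-join (V ∷ʳ s) (linked-∷ʳ V lk (n<1+n s)) lkQ)

placement-ready : ∀ {m V t s s′} → Placement m V t s → s < s′ →
  Ready (proj₂ (emit m t s)) (V ∷ʳ proj₁ (emit m t s)) s′
placement-ready {V = V} (below e lk) s<s′ rewrite e = copy-ready (linked-∷ʳ V lk s<s′)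
placement-ready (braid e s₁+i≡ _) s<s′ rewrite e = bumping-ready s₁+i≡ s<s′

readyFor-next : ∀ {m V s σ′} → (∀ {s′} → s < s′ → Ready m V s′) → Linked _<_ (s ∷ σ′) → ReadyFor m V σ′
readyFor-next {σ′ = []} _ _ = tt
readyFor-next {σ′ = _ ∷ _} ready (s<s′ ∷ _) = ready s<s′

module _ {W : Word} (reduced : Reduced W) where

  placement : ∀ {m V t s} T X → (T ++ V ++ t ∷ s ∷ X) ≈CK W → s < t → Linked _<_ V → Ready m V s →
    Placement m V t s
  placement {t = t} {s} T X ≈W s<t lkV ready with classify s<t lkV ready
  ... | inj₁ p = p
  ... | inj₂ (V′ , refl , far) = ⊥-elim (¬reduced-far-aba (T ++ V′) X s t (inj₁ far) (≈CK-reduced ≈W′ reduced))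
    where
    ≈W′ : W ≈CK ((T ++ V′) ++ s ∷ t ∷ s ∷ X)
    ≈W′ = symmetric CKStep (subst (_≈CK W)
      (trans (cong (T ++_) (∷ʳ-++ V′ s _)) (sym (++-assoc T V′ _))) ≈W)

  place : ∀ T V m {t s} τ′ σ′ → (T ++ V ++ t ∷ τ′ ++ s ∷ σ′) ≈CK W → s < t →
    Linked _<_ (V ++ t ∷ τ′) → Ready m V s →
    ((T ∷ʳ t) ++ (V ∷ʳ proj₁ (emit m t s)) ++ τ′ ++ σ′) ≈CK W ×
    Linked _<_ ((V ∷ʳ proj₁ (emit m t s)) ++ τ′) ×
    (∀ {s′} → s < s′ → Ready (proj₂ (emit m t s)) (V ∷ʳ proj₁ (emit m t s)) s′)
  place T V m {t} {s} τ′ σ′ ≈W s<t lk ready =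
    ≈W′ , placement-linked p s<t lkτ′ , placement-ready p
    where
    lkτ′ : Linked _<_ (t ∷ τ′)
    lkτ′ = linked-++⁻ʳ V lk
    pulled : (T ++ V ++ t ∷ τ′ ++ s ∷ σ′) ≈CK (T ++ V ++ t ∷ s ∷ τ′ ++ σ′)
    pulled = subst₂ _≈CK_ (++-assoc T V _) (++-assoc T V _) (pull-below-run (T ++ V) t τ′ s σ′ lkτ′ s<t)
    p : Placement m V t s
    p = placement T (τ′ ++ σ′) (transitive CKStep (symmetric CKStep pulled) ≈W) s<t (linked-++⁻ˡ V lk) ready
    open CK-Reasoning
    ≈W′ : ((T ∷ʳ t) ++ (V ∷ʳ proj₁ (emit m t s)) ++ τ′ ++ σ′) ≈CK W
    ≈W′ = begin
      (T ∷ʳ t) ++ (V ∷ʳ proj₁ (emit m t s)) ++ τ′ ++ σ′ ≡⟨ ∷ʳ-++ T t _ ⟩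
      T ++ t ∷ (V ∷ʳ proj₁ (emit m t s)) ++ τ′ ++ σ′  ≡⟨ cong (λ z → T ++ t ∷ z) (∷ʳ-++ V _ _) ⟩
      T ++ t ∷ V ++ proj₁ (emit m t s) ∷ τ′ ++ σ′     ≈⟨ placement-≈CK p s<t T (τ′ ++ σ′) ⟨
      T ++ V ++ t ∷ s ∷ τ′ ++ σ′                      ≈⟨ pulled ⟨
      T ++ V ++ t ∷ τ′ ++ s ∷ σ′                      ≈⟨ ≈W ⟩
      W                                               ∎

  dropFrom-≈CK : ∀ T V m τ′ σ′ → (T ++ V ++ τ′ ++ σ′) ≈CK W → Linked _<_ (V ++ τ′) → Linked _<_ σ′ →
    ReadyFor m V σ′ → dropFrom T V m τ′ σ′ ≈CK W
  dropFrom-≈CK T V m [] σ′ ≈W _ _ _ = ≈W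
  dropFrom-≈CK T V m (t ∷ τ′) [] ≈W _ _ _
    rewrite dropFrom-[]ʳ T V m (t ∷ τ′) | ++-identityʳ τ′ = ≈W
  dropFrom-≈CK T V m (t ∷ τ′) (s ∷ σ′) ≈W lk lkσ ready with s <? t
  ... | yes s<t =
    let ≈W′ , lk′ , ready′ = place T V m τ′ σ′ ≈W s<t lk ready in
    subst (_≈CK W) (sym (dropFrom-below T V m τ′ σ′ s<t))
      (dropFrom-≈CK (T ∷ʳ t) _ _ τ′ σ′ ≈W′ lk′ (Linked.tail lkσ) (readyFor-next ready′ lkσ))
  ... | no s≮t =
    subst (_≈CK W) (sym (dropFrom-beside T V m τ′ σ′ (≮⇒≥ s≮t)))
      (dropFrom-≈CK T (V ∷ʳ t) (gap t) τ′ (s ∷ σ′)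
        (subst (λ z → (T ++ z) ≈CK W) (sym (∷ʳ-++ V t _)) ≈W)
        (subst (Linked _<_) (sym (∷ʳ-++ V t τ′)) lk) lkσ (gap-ready (≮⇒≥ s≮t)))

lemma4p5 : (τ σ : Word) → IncreasingPos τ → IncreasingPos σ →
    Reduced (τ ++ σ) → dropWord τ σ ≈CK (τ ++ σ)
lemma4p5 τ σ (τ↑ , _) (σ↑ , _) reduced =
  subst (_≈CK (τ ++ σ)) (sym (dropWord-dropFrom τ σ))
    (dropFrom-≈CK reduced [] [] copy τ σ ε τ↑ σ↑ (initially-ready σ))
  where
  initially-ready : ∀ σ → ReadyFor copy [] σ
  initially-ready [] = tt
  initially-ready (s ∷ _) = copy-ready [-]
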